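{- Every locally directed acyclic graph admits a topological sort.
   Context: A locally directed graph is a finite multigraph without loops together with a sign $\mathrm{sgn}(v,e)\in\{+,-\}$ for each vertex $v$ and each edge $e$ incident to $v$. A locally directed closed walk is a sequence $v_1,e_1,v_2,\dots,v_t,e_t,v_{t+1}=v_1$ where each $e_i$ is an edge between $v_i$ and $v_{i+1}$, and, with $e_0=e_t$, $\mathrm{sgn}(v_i,e_i)\ne\mathrm{sgn}(v_i,e_{i-1})$ for all $i\in[t]$; the local digraph is acyclic (an LDAG) if it has none. For an LDAG $G$, an ordering $v_1,\dots,v_n$ of $V(G)$ is a topological sort if there are signs $s_1,\dots,s_n\in\{+,-\}$ such that for all $1\le i<j\le n$ and every edge $e$ between $v_i$ and $v_j$, $\mathrm{sgn}(v_i,e)=s_i$. -}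

module Defs where

open import Data.Nat using (ℕ; zero; suc; _+_)
open import Data.Nat.DivMod using (_%_; m%n<n)
open import Data.Fin using (Fin; toℕ; fromℕ<; _<_; _≟_)
open import Data.Fin.Permutation using (Permutation′; _⟨$⟩ʳ_)
open import Data.Product using (Σ; _×_; _,_)
open import Data.Sum using (_⊎_)
open import Relation.Nullary using (¬_; yes; no)
open import Relation.Binary.PropositionalEquality using (_≡_; _≢_)

data Sign : Set where
  plus minus : Sign

-- Each edge e has two endpoints
-- src e ≠ tgt e (no loops); the labels src/tgt carry no orientation, they only
-- name the two ends.  sgnSrc e = sgn(src e, e), sgnTgt e = sgn(tgt e, e).
record LocDigraph (n m : ℕ) : Set where
  field
    src tgt : Fin m → Fin n
    noLoop  : ∀ e → src e ≢ tgt e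
    sgnSrc sgnTgt : Fin m → Sign

module _ {n m : ℕ} (G : LocDigraph n m) where
  open LocDigraph G

  Between : Fin m → Fin n → Fin n → Set
  Between e u w = (src e ≡ u × tgt e ≡ w) ⊎ (src e ≡ w × tgt e ≡ u)

  -- sgn(v, e); meaningful when v is incident to e (well defined since no loops)
  sgn : Fin n → Fin m → Sign
  sgn v e with src e ≟ v
  ... | yes _ = sgnSrc e
  ... | no  _ = sgnTgt e

  nextIx : ∀ {k} → Fin (suc k) → Fin (suc k)
  nextIx {k} i = fromℕ< (m%n<n (suc (toℕ i)) (suc k))

  prevIx : ∀ {k} → Fin (suc k) → Fin (suc k)
  prevIx {k} i = fromℕ< (m%n<n (toℕ i + k) (suc k))

  -- A locally directed closed walk v_1,e_1,…,v_t,e_t,v_{t+1}=v_1 of length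
  -- t = suc k ≥ 1: vs i = v_i, es i = e_i (indices taken cyclically).
  IsLDClosedWalk : (k : ℕ) → (Fin (suc k) → Fin n) → (Fin (suc k) → Fin m) → Set
  IsLDClosedWalk k vs es =
    (∀ i → Between (es i) (vs i) (vs (nextIx i))) ×
    (∀ i → sgn (vs i) (es i) ≢ sgn (vs i) (es (prevIx i)))

  IsLDAG : Set
  IsLDAG = ∀ k (vs : Fin (suc k) → Fin n) (es : Fin (suc k) → Fin m) →
           ¬ IsLDClosedWalk k vs es

  -- The ordering v_1,…,v_n is given by a permutation σ: position i ↦ vertex.
  IsTopologicalSort : Permutation′ n → Set
  IsTopologicalSort σ =
    Σ (Fin n → Sign) λ s →
      ∀ (i j : Fin n) → i < j → ∀ (e : Fin m) →
        Between e (σ ⟨$⟩ʳ i) (σ ⟨$⟩ʳ j) → sgn (σ ⟨$⟩ʳ i) e ≡ s i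

-- A vertex all of whose edges carry one sign s can be placed first with sign s;
-- deleting it leaves an LDAG, so induction on the number of vertices sorts the
-- rest. Such a vertex exists: otherwise every vertex has edges of both signs to
-- other vertices, and from each state (vertex, sign) we can leave along an edge
-- of that sign and arrive with the opposite of the sign the edge has there.
-- Among the finitely many states this process eventually cycles, and the cycle
-- is a locally directed closed walk.
module Submission where

open import Defs
open import Data.Nat using (ℕ; zero; suc; _+_; _*_; _∸_; s≤s; NonZero)
open import Data.Nat.DivMod using (_%_; _/_; m%n<n; m≡m%n+[m/n]*n)
open import Data.Nat.GeneralisedArithmetic using (fold; fold-+)
open import Data.Nat.Properties using (n<1+n; +-identityʳ; +-assoc; +-comm; +-suc; m+[n∸m]≡n)
open import Data.Fin using (Fin; toℕ; fromℕ<; punchIn; combine; _≟_; _<_)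
open import Data.Fin.Properties using (any?; all?; pigeonhole; toℕ-fromℕ<; ¬∀⟶∃¬; combine-injective)
open import Data.Fin.Permutation using (Permutation′; _⟨$⟩ʳ_; insert; id)
open import Data.Product using (Σ; _×_; _,_; proj₁; proj₂; ∃₂)
open import Data.Sum using (_⊎_; inj₁; inj₂)
open import Data.Empty using (⊥-elim)
open import Function.Definitions using (Injective)
open import Relation.Nullary using (¬_; Dec; yes; no)
open import Relation.Nullary.Decidable using (_×-dec_; _⊎-dec_; map′)
open import Relation.Binary.PropositionalEquality

flip : Sign → Sign
flip plus  = minus
flip minus = plus

≢-flip : ∀ s → s ≢ flip s
≢-flip plus  ()
≢-flip minus ()

≢⇒≡flip : ∀ {t s} → t ≢ s → t ≡ flip s
≢⇒≡flip {plus}  {plus}  t≢s = ⊥-elim (t≢s refl)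
≢⇒≡flip {plus}  {minus} _   = refl
≢⇒≡flip {minus} {plus}  _   = refl
≢⇒≡flip {minus} {minus} t≢s = ⊥-elim (t≢s refl)

_≟ˢ_ : (s t : Sign) → Dec (s ≡ t)
plus  ≟ˢ plus  = yes refl
minus ≟ˢ minus = yes refl
plus  ≟ˢ minus = no λ ()
minus ≟ˢ plus  = no λ ()

signIndex : Sign → Fin 2
signIndex plus  = Fin.zero
signIndex minus = Fin.suc Fin.zero

signIndex-injective : Injective _≡_ _≡_ signIndex
signIndex-injective {plus}  {plus}  _ = refl
signIndex-injective {minus} {minus} _ = refl

periodic-+* : ∀ {A : Set} (g : ℕ → A) p → (∀ y → g (y + p) ≡ g y) →
              ∀ q r → g (r + q * p) ≡ g r
periodic-+* g p period zero    r = cong g (+-identityʳ r)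
periodic-+* g p period (suc q) r = begin
  g (r + (p + q * p))   ≡⟨ cong g (cong (r +_) (+-comm p (q * p))) ⟩
  g (r + (q * p + p))   ≡⟨ cong g (sym (+-assoc r (q * p) p)) ⟩
  g (r + q * p + p)     ≡⟨ period (r + q * p) ⟩
  g (r + q * p)         ≡⟨ periodic-+* g p period q r ⟩
  g r                   ∎
  where open ≡-Reasoning

periodic⇒≡mod : ∀ {A : Set} (g : ℕ → A) p .{{_ : NonZero p}} →
                (∀ y → g (y + p) ≡ g y) → ∀ y → g y ≡ g (y % p)
periodic⇒≡mod g p period y =
  trans (cong g (m≡m%n+[m/n]*n y p)) (periodic-+* g p period (y / p) (y % p))

fold-periodic : ∀ {A : Set} (f : A → A) {z : A} p →
                fold z f p ≡ z → ∀ y → fold z f (y + p) ≡ fold z f y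
fold-periodic f {z} p period y = trans (fold-+ z f y) (cong (λ w → fold w f y) period)

periodic-point : ∀ {A : Set} {N} (enc : A → Fin N) → Injective _≡_ _≡_ enc →
                 (f : A → A) → A → ∃₂ λ z k → fold z f (suc k) ≡ z
periodic-point {N = N} enc enc-injective f x
  with i , j , i<j , same ← pigeonhole (n<1+n N) (λ i → enc (fold x f (toℕ i)))
  = orbit (toℕ i) , toℕ j ∸ suc (toℕ i) , (begin
      fold (orbit (toℕ i)) f (suc (toℕ j ∸ suc (toℕ i)))  ≡⟨ sym (fold-+ x f (suc (toℕ j ∸ suc (toℕ i)))) ⟩
      orbit (suc (toℕ j ∸ suc (toℕ i)) + toℕ i)          ≡⟨ cong orbit (+-comm _ (toℕ i)) ⟩
      orbit (toℕ i + suc (toℕ j ∸ suc (toℕ i)))          ≡⟨ cong orbit (+-suc (toℕ i) _) ⟩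
      orbit (suc (toℕ i) + (toℕ j ∸ suc (toℕ i)))        ≡⟨ cong orbit (m+[n∸m]≡n i<j) ⟩
      orbit (toℕ j)                                      ≡⟨ sym (enc-injective same) ⟩
      orbit (toℕ i)                                      ∎)
  where
  open ≡-Reasoning
  orbit : ℕ → _
  orbit = fold x f

-- Copies of nextIx and prevIx of Defs (which take an unused LocDigraph
-- argument), so that IsLDAG G unfolds to Acyclic (forget G).
next : ∀ {k} → Fin (suc k) → Fin (suc k)
next {k} i = fromℕ< (m%n<n (suc (toℕ i)) (suc k))

prev : ∀ {k} → Fin (suc k) → Fin (suc k)
prev {k} i = fromℕ< (m%n<n (toℕ i + k) (suc k))

-- Only incidences and signs matter, so deleting a vertex just restricts the
-- vertex set and keeps all edges: those incident to the deleted vertex are no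
-- longer Joins-related to anything.
record SignedGraph (n m : ℕ) : Set₁ where
  field
    Joins  : Fin m → Fin n → Fin n → Set
    joins? : ∀ e u w → Dec (Joins e u w)
    sign   : Fin n → Fin m → Sign

forget : ∀ {n m} → LocDigraph n m → SignedGraph n m
forget G = record { Joins = Between G ; joins? = between? ; sign = sgn G }
  where
  open LocDigraph G
  between? : ∀ e u w → Dec (Between G e u w)
  between? e u w = ((src e ≟ u) ×-dec (tgt e ≟ w)) ⊎-dec ((src e ≟ w) ×-dec (tgt e ≟ u))

module _ {n m : ℕ} (G : SignedGraph n m) where
  open SignedGraph G

  IsClosedWalk : (k : ℕ) → (Fin (suc k) → Fin n) → (Fin (suc k) → Fin m) → Set
  IsClosedWalk k vs es =
    (∀ i → Joins (es i) (vs i) (vs (next i))) ×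
    (∀ i → sign (vs i) (es i) ≢ sign (vs i) (es (prev i)))

  Acyclic : Set
  Acyclic = ∀ k vs es → ¬ IsClosedWalk k vs es

  IsTopologicalSort′ : Permutation′ n → Set
  IsTopologicalSort′ σ =
    Σ (Fin n → Sign) λ s → ∀ i j → i < j → ∀ e →
      Joins e (σ ⟨$⟩ʳ i) (σ ⟨$⟩ʳ j) → sign (σ ⟨$⟩ʳ i) e ≡ s i

delete : ∀ {n m} → SignedGraph (suc n) m → Fin (suc n) → SignedGraph n m
delete G v = record
  { Joins  = λ e u w → Joins e (punchIn v u) (punchIn v w)
  ; joins? = λ e u w → joins? e (punchIn v u) (punchIn v w)
  ; sign   = λ u e → sign (punchIn v u) e
  }
  where open SignedGraph G

delete-acyclic : ∀ {n m} (G : SignedGraph (suc n) m) v → Acyclic G → Acyclic (delete G v)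
delete-acyclic G v acyclic k vs es = acyclic k (λ i → punchIn v (vs i)) es

module _ {n m : ℕ} (G : SignedGraph (suc n) m) where
  open SignedGraph G

  Source : Fin (suc n) → Sign → Set
  Source v s = ∀ e u → Joins e v (punchIn v u) → sign v e ≡ s

  record Exit (x : Fin (suc n)) (s : Sign) : Set where
    constructor exit
    field
      edge   : Fin m
      other  : Fin n
      joins  : Joins edge x (punchIn x other)
      signed : sign x edge ≡ s

  exit? : ∀ x s → Dec (Exit x s)
  exit? x s = map′ (λ (e , u , j , signed) → exit e u j signed)
                   (λ (exit e u j signed) → e , u , j , signed)
                   (any? λ e → any? λ u → joins? e x (punchIn x u) ×-dec (sign x e ≟ˢ s))

  ¬Exit⇒Source : ∀ {x s} → ¬ Exit x s → Source x (flip s)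
  ¬Exit⇒Source ¬exit e u joins = ≢⇒≡flip λ signed → ¬exit (exit e u joins signed)

  source-or-exits : (∃₂ Source) ⊎ (∀ x s → Exit x s)
  source-or-exits with all? (λ x → exit? x plus ×-dec exit? x minus)
  ... | yes both = inj₂ λ { x plus → proj₁ (both x) ; x minus → proj₂ (both x) }
  ... | no ¬both with x , ¬exits ← ¬∀⟶∃¬ _ _ (λ x → exit? x plus ×-dec exit? x minus) ¬both
                 with exit? x plus
  ...   | no ¬plus  = inj₁ (x , minus , ¬Exit⇒Source ¬plus)
  ...   | yes exit⁺ = inj₁ (x , plus , ¬Exit⇒Source {s = minus} λ exit⁻ → ¬exits (exit⁺ , exit⁻))

  module _ (exits : ∀ x s → Exit x s) where
    State : Set
    State = Fin (suc n) × Sign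

    edge : State → Fin m
    edge (x , s) = Exit.edge (exits x s)

    step : State → State
    step (x , s) = y , flip (sign y (edge (x , s)))
      where y = punchIn x (Exit.other (exits x s))

    edge-sign : ∀ P → sign (proj₁ P) (edge P) ≡ proj₂ P
    edge-sign (x , s) = Exit.signed (exits x s)

    step-joins : ∀ {P Q} → step P ≡ Q → Joins (edge P) (proj₁ P) (proj₁ Q)
    step-joins {x , s} refl = Exit.joins (exits x s)

    step-sign : ∀ {P Q} → step P ≡ Q → proj₂ Q ≡ flip (sign (proj₁ Q) (edge P))
    step-sign refl = refl

    encode : State → Fin (2 * suc n)
    encode (x , s) = combine (signIndex s) x

    encode-injective : Injective _≡_ _≡_ encode
    encode-injective {x , s} {y , t} same
      with same-sign , refl ← combine-injective (signIndex s) x (signIndex t) y same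
      = cong (x ,_) (signIndex-injective same-sign)

    cycle⇒closedWalk : ∀ z k → fold z step (suc k) ≡ z →
                       IsClosedWalk G k (λ c → proj₁ (fold z step (toℕ c)))
                                        (λ c → edge (fold z step (toℕ c)))
    cycle⇒closedWalk z k period = joins , alternates
      where
      T : ℕ → State
      T = fold z step

      T-mod : ∀ y → T y ≡ T (y % suc k)
      T-mod = periodic⇒≡mod T (suc k) (fold-periodic step (suc k) period)

      step-into-next : ∀ c → step (T (toℕ c)) ≡ T (toℕ (next c))
      step-into-next c = trans (T-mod (suc (toℕ c)))
                               (sym (cong T (toℕ-fromℕ< (m%n<n (suc (toℕ c)) (suc k)))))

      step-from-prev : ∀ c → step (T (toℕ (prev c))) ≡ T (toℕ c)
      step-from-prev c = begin
        step (T (toℕ (prev c)))         ≡⟨ cong (λ y → step (T y)) (toℕ-fromℕ< (m%n<n (toℕ c + k) (suc k))) ⟩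
        step (T ((toℕ c + k) % suc k))  ≡⟨ cong step (sym (T-mod (toℕ c + k))) ⟩
        T (suc (toℕ c + k))             ≡⟨ cong T (sym (+-suc (toℕ c) k)) ⟩
        T (toℕ c + suc k)               ≡⟨ fold-periodic step (suc k) period (toℕ c) ⟩
        T (toℕ c)                       ∎
        where open ≡-Reasoning

      joins : ∀ c → Joins (edge (T (toℕ c))) (proj₁ (T (toℕ c))) (proj₁ (T (toℕ (next c))))
      joins c = step-joins (step-into-next c)

      alternates : ∀ c → sign (proj₁ (T (toℕ c))) (edge (T (toℕ c)))
                       ≢ sign (proj₁ (T (toℕ c))) (edge (T (toℕ (prev c))))
      alternates c same =
        ≢-flip _ (trans (sym same) (trans (edge-sign (T (toℕ c))) (step-sign (step-from-prev c))))

    exits⇒¬acyclic : ¬ Acyclic G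
    exits⇒¬acyclic acyclic
      with z , k , period ← periodic-point encode encode-injective step (Fin.zero , plus)
      = acyclic k _ _ (cycle⇒closedWalk z k period)

  acyclic⇒source : Acyclic G → ∃₂ Source
  acyclic⇒source acyclic with source-or-exits
  ... | inj₁ source = source
  ... | inj₂ exits  = ⊥-elim (exits⇒¬acyclic exits acyclic)

topologicalSort : ∀ {m} n (G : SignedGraph n m) → Acyclic G →
                  Σ (Permutation′ n) (IsTopologicalSort′ G)
topologicalSort zero    G acyclic = id , (λ _ → plus) , λ ()
topologicalSort (suc n) G acyclic
  with v , s , source ← acyclic⇒source G acyclic
  with σ , signs , sorted ← topologicalSort n (delete G v) (delete-acyclic G v acyclic)
  = τ , signs′ , sorted′
  where
  open SignedGraph G

  τ : Permutation′ (suc n)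
  τ = insert Fin.zero v σ

  signs′ : Fin (suc n) → Sign
  signs′ Fin.zero    = s
  signs′ (Fin.suc i) = signs i

  sorted′ : ∀ i j → i < j → ∀ e → Joins e (τ ⟨$⟩ʳ i) (τ ⟨$⟩ʳ j) → sign (τ ⟨$⟩ʳ i) e ≡ signs′ i
  sorted′ Fin.zero    (Fin.suc j) _         e joins = source e (σ ⟨$⟩ʳ j) joins
  sorted′ (Fin.suc i) (Fin.suc j) (s≤s i<j) e joins = sorted i j i<j e joins

proposition4p8 : ∀ (n m : ℕ) (G : LocDigraph n m) → IsLDAG G →
    Σ (Permutation′ n) λ σ → IsTopologicalSort G σ
proposition4p8 n m G = topologicalSort n (forget G)
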